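{- Let $n\ge1$ and let $\lambda\vdash n$. For $P,Q\in\mathcal{S}_n$ of shape $\lambda$, the rational function $$\zeta_{P,Q}(q)=\frac{\rho(P)\rho(Q)}{(1-q)^n\Delta(\lambda)}$$ is a polynomial in $q$ with integer coefficients. Consequently $$\theta_\lambda(q)=\sum_{P,Q\in\mathcal{S}_n:\mathrm{sh}P=\mathrm{sh}Q=\lambda}\zeta_{P,Q}(q)\in\mathbb{Z}[q].$$
   Context: Notation. $(m)_q=(1-q)\cdots(1-q^m)$, with $(0)_q=1$. $\mathcal{S}_n$ is the set of standard Young tableaux of size $n$. The function $\rho$. For $Q\in\mathcal{S}_n$, let $\mu^i$ be the shape of the subtableau of entries $\le i$ ($\mu^0=\emptyset$), with parts $\mu^i_j$ ($=0$ beyond the length). Then $\rho(Q)=\prod(1-q^{\mu^i_j-\mu^i_{j+1}})$, over pairs $(i,j)$ with $1\le i\le n$ and $\mu^i_j-\mu^{i-1}_j=1$, i.e. $j$ is the row of the box containing $i$. The quantity $\Delta$. $\Delta(\lambda)=\prod_{i=1}^{\ell(\lambda)}(\lambda_i-\lambda_{i+1})_q$, where $\ell(\lambda)$ is the number of parts. -}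

module Defs where

open import Data.Nat as ℕ using (ℕ; zero; suc; _∸_)
open import Data.Integer as ℤ using (ℤ; +_; -_)
open import Data.Bool using (Bool; true; false; _∧_; if_then_else_)
open import Data.List using (List; []; _∷_; map; concatMap; filter; foldr; length; reverse; upTo)
open import Data.Product using (_×_; _,_)
open import Relation.Binary.PropositionalEquality using (_≡_)
open import Relation.Nullary.Decidable using (yes; no)
open import Data.Bool using (_≟_)

-- Polynomials in q with integer coefficients: coefficient lists,
-- lowest degree first.  Equality is coefficientwise (trailing zeros
-- are irrelevant).

Poly : Set
Poly = List ℤ

coeff : Poly → ℕ → ℤ
coeff []       _       = + 0
coeff (a ∷ _)  zero    = a
coeff (_ ∷ as) (suc k) = coeff as k

_≈ₚ_ : Poly → Poly → Set
p ≈ₚ r = ∀ k → coeff p k ≡ coeff r k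

infix 4 _≈ₚ_
infixl 6 _+ₚ_
infixl 7 _*ₚ_ _·ₚ_

_+ₚ_ : Poly → Poly → Poly
[]       +ₚ r        = r
(a ∷ as) +ₚ []       = a ∷ as
(a ∷ as) +ₚ (b ∷ bs) = (a ℤ.+ b) ∷ (as +ₚ bs)

_·ₚ_ : ℤ → Poly → Poly
c ·ₚ p = map (c ℤ.*_) p

_*ₚ_ : Poly → Poly → Poly
[]       *ₚ _ = []
(a ∷ as) *ₚ r = (a ·ₚ r) +ₚ (+ 0 ∷ (as *ₚ r))

oneₚ : Poly
oneₚ = + 1 ∷ []

prodₚ : List Poly → Poly
prodₚ = foldr _*ₚ_ oneₚ

sumₚ : List Poly → Poly
sumₚ = foldr _+ₚ_ []

qpow : ℕ → Poly
qpow zero    = + 1 ∷ []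
qpow (suc k) = + 0 ∷ qpow k

oneMinusQ^ : ℕ → Poly
oneMinusQ^ k = oneₚ +ₚ ((- (+ 1)) ·ₚ qpow k)

oneMinusQPow : ℕ → Poly
oneMinusQPow zero    = oneₚ
oneMinusQPow (suc n) = oneMinusQ^ 1 *ₚ oneMinusQPow n

qfact : ℕ → Poly
qfact zero    = oneₚ
qfact (suc m) = qfact m *ₚ oneMinusQ^ (suc m)

-- A shape is a list of row lengths (row 0 first).  A partition is a
-- weakly decreasing list of positive integers.

nth : List ℕ → ℕ → ℕ
nth []       _       = 0
nth (x ∷ _)  zero    = x
nth (_ ∷ xs) (suc j) = nth xs j

geqB : ℕ → ℕ → Bool
geqB m n with n ℕ.≤? m
... | yes _ = true
... | no  _ = false

isPartitionB : List ℕ → Bool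
isPartitionB []           = true
isPartitionB (zero ∷ _)   = false
isPartitionB (suc x ∷ []) = true
isPartitionB (suc x ∷ y ∷ ys) = geqB (suc x) y ∧ isPartitionB (y ∷ ys)

IsPartition : List ℕ → Set
IsPartition μ = isPartitionB μ ≡ true

sumℕ : List ℕ → ℕ
sumℕ = foldr ℕ._+_ 0

_⊢_ : List ℕ → ℕ → Set
λ' ⊢ n = IsPartition λ' × (sumℕ λ' ≡ n)

-- add a box at the end of row r (0-based); missing rows are created
-- with length 0 (which then fails the partition test)
addBox : ℕ → List ℕ → List ℕ
addBox zero    []       = 1 ∷ []
addBox zero    (x ∷ xs) = suc x ∷ xs
addBox (suc r) []       = 0 ∷ addBox r []
addBox (suc r) (x ∷ xs) = x ∷ addBox r xs

-- A standard Young tableau of size n is encoded by its row word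
-- w = (r_1, ..., r_n): entry i lies in row r_i (0-based).  The shapes
-- μ^i of the subtableaux of entries ≤ i are obtained by successively
-- adding boxes; the word is a standard tableau iff every μ^i is a
-- partition.

validFrom : List ℕ → List ℕ → Bool
validFrom μ []      = true
validFrom μ (r ∷ w) = isPartitionB (addBox r μ) ∧ validFrom (addBox r μ) w

shapeFrom : List ℕ → List ℕ → List ℕ
shapeFrom μ []      = μ
shapeFrom μ (r ∷ w) = shapeFrom (addBox r μ) w

Tableau : Set
Tableau = List ℕ

IsSYT : Tableau → Set
IsSYT w = validFrom [] w ≡ true

sh : Tableau → List ℕ
sh w = shapeFrom [] w

rhoFrom : List ℕ → Tableau → Poly
rhoFrom μ []      = oneₚ
rhoFrom μ (r ∷ w) =
  oneMinusQ^ (nth (addBox r μ) r ∸ nth (addBox r μ) (suc r))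
    *ₚ rhoFrom (addBox r μ) w

ρ : Tableau → Poly
ρ = rhoFrom []

Δ : List ℕ → Poly
Δ []       = oneₚ
Δ (x ∷ xs) = qfact (x ∸ nth xs 0) *ₚ Δ xs

-- Enumeration of 𝒮_n restricted to a shape: all words of length n with
-- letters < n (every SYT of size n has all rows < n), filtered by IsSYT
-- and shape.

words : ℕ → ℕ → List (List ℕ)
words k zero    = [] ∷ []
words k (suc n) = concatMap (λ r → map (r ∷_) (words k n)) (upTo k)

listEqℕB : List ℕ → List ℕ → Bool
listEqℕB []       []       = true
listEqℕB (x ∷ xs) (y ∷ ys) with x ℕ.≟ y
... | yes _ = listEqℕB xs ys
... | no  _ = false
listEqℕB _        _        = false

sytsOfShape : ℕ → List ℕ → List Tableau
sytsOfShape n λ' =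
  filter (λ w → (validFrom [] w ∧ listEqℕB (sh w) λ') ≟ true) (words n n)

-- ζ_{P,Q} numerator: ρ(P)ρ(Q); denominator (1-q)^n Δ(λ)
-- θ_λ numerator (over the common denominator (1-q)^n Δ(λ)):
thetaNum : ℕ → List ℕ → Poly
thetaNum n λ' =
  sumₚ (concatMap (λ P → map (λ Q → ρ P *ₚ ρ Q) (sytsOfShape n λ'))
                  (sytsOfShape n λ'))

-- Write a tableau as its row word w, so that ρ(w) is the product, over
-- the successive box additions μ ↦ μ + □ (in row r), of the factor
-- 1 - q^{a}, a = μ'_r - μ'_{r+1} the gap of the enlarged shape μ'.
-- Two divisibilities then give the theorem:
--
--   * (1-q) divides every 1 - q^a, so (1-q)^n divides ρ(P) for |P| = n;
--   * Δ(μ + □) divides Δ(μ)·(1 - q^a): only the factors of Δ for the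
--     rows r and r-1 change, the first growing from (a-1)_q to (a)_q,
--     the second shrinking.  Telescoping along Q gives Δ(sh Q) ∣ ρ(Q).
--
-- Multiplying, (1-q)^n Δ(λ) divides ρ(P)ρ(Q), and hence also the sum θ_λ.
-- Neither divisibility needs the intermediate shapes to be partitions,
-- so they are proved for arbitrary row words.

module Submission where

open import Defs
open import Level using (0ℓ)
open import Algebra.Bundles using (CommutativeSemiring; CommutativeMonoid)
open import Algebra.Structures.Biased using (isCommutativeMonoidˡ; isCommutativeSemiringˡ)
open import Data.Nat as ℕ using (ℕ; zero; suc; _∸_; _≤_; _≤′_; _≥_; z≤n)
import Data.Nat.Properties as ℕP
open import Data.Integer as ℤ using (ℤ; +_)
import Data.Integer.Properties as ℤP
open import Data.Bool as Bool using (true; _∧_)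
open import Data.List using (List; []; _∷_; length)
open import Data.List.Relation.Unary.All as All using (All; []; _∷_)
open import Data.List.Relation.Unary.All.Properties using (all-filter; map⁺; concat⁺)
open import Data.Product using (Σ; _×_; _,_)
open import Relation.Binary.Structures using (IsEquivalence)
open import Relation.Binary.PropositionalEquality as ≡ using (_≡_; refl; cong; cong₂)
open import Relation.Nullary using (yes; no)

-- It is wrapped in a record
-- because the function type  p ≈ₚ r  does not determine p and r, which
-- would defeat inference of implicit arguments in the algebra below.
infix 4 _≋_
record _≋_ (p r : Poly) : Set where
  constructor ⟨_⟩
  field coeff-≡ : p ≈ₚ r
open _≋_

≋-isEquivalence : IsEquivalence _≋_
≋-isEquivalence = record
  { refl  = ⟨ (λ _ → refl) ⟩
  ; sym   = λ e → ⟨ (λ k → ≡.sym (coeff-≡ e k)) ⟩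
  ; trans = λ e f → ⟨ (λ k → ≡.trans (coeff-≡ e k) (coeff-≡ f k)) ⟩
  }

private module ≋ = IsEquivalence ≋-isEquivalence

∷-cong : ∀ {a b p r} → a ≡ b → p ≋ r → a ∷ p ≋ b ∷ r
∷-cong a≡b p≋r = ⟨ (λ { zero → a≡b ; (suc k) → coeff-≡ p≋r k }) ⟩

zero∷[] : + 0 ∷ [] ≋ []
zero∷[] = ⟨ (λ { zero → refl ; (suc k) → refl }) ⟩

coeff-+ : ∀ p r k → coeff (p +ₚ r) k ≡ coeff p k ℤ.+ coeff r k
coeff-+ []       r        k       = ≡.sym (ℤP.+-identityˡ _)
coeff-+ (a ∷ as) []       k       = ≡.sym (ℤP.+-identityʳ _)
coeff-+ (a ∷ as) (b ∷ bs) zero    = refl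
coeff-+ (a ∷ as) (b ∷ bs) (suc k) = coeff-+ as bs k

coeff-· : ∀ c p k → coeff (c ·ₚ p) k ≡ c ℤ.* coeff p k
coeff-· c []      k       = ≡.sym (ℤP.*-zeroʳ c)
coeff-· c (a ∷ p) zero    = refl
coeff-· c (a ∷ p) (suc k) = coeff-· c p k

+-cong : ∀ {p p' r r'} → p ≋ p' → r ≋ r' → p +ₚ r ≋ p' +ₚ r'
+-cong {p} {p'} {r} {r'} e f = ⟨ (λ k → begin
  coeff (p +ₚ r) k             ≡⟨ coeff-+ p r k ⟩
  coeff p k ℤ.+ coeff r k      ≡⟨ cong₂ ℤ._+_ (coeff-≡ e k) (coeff-≡ f k) ⟩
  coeff p' k ℤ.+ coeff r' k    ≡⟨ ≡.sym (coeff-+ p' r' k) ⟩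
  coeff (p' +ₚ r') k           ∎) ⟩
  where open ≡.≡-Reasoning

+-assoc : ∀ p r s → (p +ₚ r) +ₚ s ≋ p +ₚ (r +ₚ s)
+-assoc p r s = ⟨ (λ k → begin
  coeff ((p +ₚ r) +ₚ s) k                  ≡⟨ coeff-+ (p +ₚ r) s k ⟩
  coeff (p +ₚ r) k ℤ.+ coeff s k           ≡⟨ cong (ℤ._+ coeff s k) (coeff-+ p r k) ⟩
  (coeff p k ℤ.+ coeff r k) ℤ.+ coeff s k  ≡⟨ ℤP.+-assoc (coeff p k) _ _ ⟩
  coeff p k ℤ.+ (coeff r k ℤ.+ coeff s k)  ≡⟨ cong (λ x → coeff p k ℤ.+ x) (≡.sym (coeff-+ r s k)) ⟩
  coeff p k ℤ.+ coeff (r +ₚ s) k           ≡⟨ ≡.sym (coeff-+ p (r +ₚ s) k) ⟩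
  coeff (p +ₚ (r +ₚ s)) k                  ∎) ⟩
  where open ≡.≡-Reasoning

+-comm : ∀ p r → p +ₚ r ≋ r +ₚ p
+-comm p r = ⟨ (λ k → begin
  coeff (p +ₚ r) k          ≡⟨ coeff-+ p r k ⟩
  coeff p k ℤ.+ coeff r k   ≡⟨ ℤP.+-comm (coeff p k) _ ⟩
  coeff r k ℤ.+ coeff p k   ≡⟨ ≡.sym (coeff-+ r p k) ⟩
  coeff (r +ₚ p) k          ∎) ⟩
  where open ≡.≡-Reasoning

+-commutativeMonoid : CommutativeMonoid 0ℓ 0ℓ
+-commutativeMonoid = record
  { Carrier = Poly ; _≈_ = _≋_ ; _∙_ = _+ₚ_ ; ε = []
  ; isCommutativeMonoid = isCommutativeMonoidˡ record
    { isSemigroup = record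
      { isMagma = record { isEquivalence = ≋-isEquivalence ; ∙-cong = +-cong }
      ; assoc   = +-assoc }
    ; identityˡ = λ _ → ≋.refl
    ; comm      = +-comm } }

private module + = CommutativeMonoid +-commutativeMonoid
open import Algebra.Properties.CommutativeSemigroup +.commutativeSemigroup
  using (interchange; x∙yz≈y∙xz)

·-congˡ : ∀ {c d} → c ≡ d → ∀ p → c ·ₚ p ≋ d ·ₚ p
·-congˡ refl p = ≋.refl

·-congʳ : ∀ c {p r} → p ≋ r → c ·ₚ p ≋ c ·ₚ r
·-congʳ c {p} {r} e = ⟨ (λ k → begin
  coeff (c ·ₚ p) k   ≡⟨ coeff-· c p k ⟩
  c ℤ.* coeff p k    ≡⟨ cong (c ℤ.*_) (coeff-≡ e k) ⟩
  c ℤ.* coeff r k    ≡⟨ ≡.sym (coeff-· c r k) ⟩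
  coeff (c ·ₚ r) k   ∎) ⟩
  where open ≡.≡-Reasoning

·-distribˡ : ∀ c p r → c ·ₚ (p +ₚ r) ≋ c ·ₚ p +ₚ c ·ₚ r
·-distribˡ c p r = ⟨ (λ k → begin
  coeff (c ·ₚ (p +ₚ r)) k                    ≡⟨ coeff-· c (p +ₚ r) k ⟩
  c ℤ.* coeff (p +ₚ r) k                     ≡⟨ cong (c ℤ.*_) (coeff-+ p r k) ⟩
  c ℤ.* (coeff p k ℤ.+ coeff r k)            ≡⟨ ℤP.*-distribˡ-+ c _ _ ⟩
  c ℤ.* coeff p k ℤ.+ c ℤ.* coeff r k        ≡⟨ ≡.sym (cong₂ ℤ._+_ (coeff-· c p k) (coeff-· c r k)) ⟩
  coeff (c ·ₚ p) k ℤ.+ coeff (c ·ₚ r) k      ≡⟨ ≡.sym (coeff-+ (c ·ₚ p) (c ·ₚ r) k) ⟩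
  coeff (c ·ₚ p +ₚ c ·ₚ r) k                 ∎) ⟩
  where open ≡.≡-Reasoning

·-distribʳ : ∀ c d p → (c ℤ.+ d) ·ₚ p ≋ c ·ₚ p +ₚ d ·ₚ p
·-distribʳ c d p = ⟨ (λ k → begin
  coeff ((c ℤ.+ d) ·ₚ p) k                   ≡⟨ coeff-· (c ℤ.+ d) p k ⟩
  (c ℤ.+ d) ℤ.* coeff p k                    ≡⟨ ℤP.*-distribʳ-+ (coeff p k) c d ⟩
  c ℤ.* coeff p k ℤ.+ d ℤ.* coeff p k        ≡⟨ ≡.sym (cong₂ ℤ._+_ (coeff-· c p k) (coeff-· d p k)) ⟩
  coeff (c ·ₚ p) k ℤ.+ coeff (d ·ₚ p) k      ≡⟨ ≡.sym (coeff-+ (c ·ₚ p) (d ·ₚ p) k) ⟩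
  coeff (c ·ₚ p +ₚ d ·ₚ p) k                 ∎) ⟩
  where open ≡.≡-Reasoning

·-assoc : ∀ c d p → c ·ₚ (d ·ₚ p) ≋ (c ℤ.* d) ·ₚ p
·-assoc c d p = ⟨ (λ k → begin
  coeff (c ·ₚ (d ·ₚ p)) k      ≡⟨ coeff-· c (d ·ₚ p) k ⟩
  c ℤ.* coeff (d ·ₚ p) k       ≡⟨ cong (c ℤ.*_) (coeff-· d p k) ⟩
  c ℤ.* (d ℤ.* coeff p k)      ≡⟨ ≡.sym (ℤP.*-assoc c d _) ⟩
  (c ℤ.* d) ℤ.* coeff p k      ≡⟨ ≡.sym (coeff-· (c ℤ.* d) p k) ⟩
  coeff ((c ℤ.* d) ·ₚ p) k     ∎) ⟩
  where open ≡.≡-Reasoning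

·-zero : ∀ p → + 0 ·ₚ p ≋ []
·-zero p = ⟨ (λ k → ≡.trans (coeff-· (+ 0) p k) (ℤP.*-zeroˡ (coeff p k))) ⟩

·-one : ∀ p → + 1 ·ₚ p ≋ p
·-one p = ⟨ (λ k → ≡.trans (coeff-· (+ 1) p k) (ℤP.*-identityˡ (coeff p k))) ⟩

shift-+ : ∀ p r → + 0 ∷ (p +ₚ r) ≋ (+ 0 ∷ p) +ₚ (+ 0 ∷ r)
shift-+ p r = ∷-cong (≡.sym (ℤP.+-identityʳ (+ 0))) ≋.refl

-- A polynomial with all coefficients zero annihilates everything; this
-- is what makes multiplication respect trailing zeros.
*-annihilate : ∀ {p} r → p ≋ [] → p *ₚ r ≋ []
*-annihilate {[]}     r e = ≋.refl
*-annihilate {a ∷ as} r e =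
  ≋.trans (+-cong (≋.trans (·-congˡ (coeff-≡ e zero) r) (·-zero r))
                  (∷-cong refl (*-annihilate {as} r ⟨ (λ k → coeff-≡ e (suc k)) ⟩)))
          zero∷[]

*-zeroʳ : ∀ p → p *ₚ [] ≋ []
*-zeroʳ []       = ≋.refl
*-zeroʳ (a ∷ as) = ≋.trans (∷-cong refl (*-zeroʳ as)) zero∷[]

*-congˡ : ∀ {p p'} r → p ≋ p' → p *ₚ r ≋ p' *ₚ r
*-congˡ {[]}     {[]}     r e = ≋.refl
*-congˡ {[]}     {b ∷ bs} r e = ≋.sym (*-annihilate r (≋.sym e))
*-congˡ {a ∷ as} {[]}     r e = *-annihilate r e
*-congˡ {a ∷ as} {b ∷ bs} r e =
  +-cong (·-congˡ (coeff-≡ e zero) r)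
         (∷-cong refl (*-congˡ {as} {bs} r ⟨ (λ k → coeff-≡ e (suc k)) ⟩))

*-congʳ : ∀ p {r r'} → r ≋ r' → p *ₚ r ≋ p *ₚ r'
*-congʳ []       e = ≋.refl
*-congʳ (a ∷ as) e = +-cong (·-congʳ a e) (∷-cong refl (*-congʳ as e))

*-cong : ∀ {p p' r r'} → p ≋ p' → r ≋ r' → p *ₚ r ≋ p' *ₚ r'
*-cong {p' = p'} {r = r} e f = ≋.trans (*-congˡ r e) (*-congʳ p' f)

*-distribʳ : ∀ p p' r → (p +ₚ p') *ₚ r ≋ p *ₚ r +ₚ p' *ₚ r
*-distribʳ []       p'       r = ≋.refl
*-distribʳ (a ∷ as) []       r = ≋.sym (+.identityʳ _)
*-distribʳ (a ∷ as) (b ∷ bs) r =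
  ≋.trans (+-cong (·-distribʳ a b r)
                  (≋.trans (∷-cong refl (*-distribʳ as bs r)) (shift-+ (as *ₚ r) (bs *ₚ r))))
          (interchange (a ·ₚ r) (b ·ₚ r) _ _)

·-*-assoc : ∀ c p r → (c ·ₚ p) *ₚ r ≋ c ·ₚ (p *ₚ r)
·-*-assoc c []       r = ≋.refl
·-*-assoc c (a ∷ as) r =
  ≋.trans (+-cong (≋.sym (·-assoc c a r)) (∷-cong (≡.sym (ℤP.*-zeroʳ c)) (·-*-assoc c as r)))
          (≋.sym (·-distribˡ c (a ·ₚ r) (+ 0 ∷ (as *ₚ r))))

shift-* : ∀ p r → (+ 0 ∷ p) *ₚ r ≋ + 0 ∷ (p *ₚ r)
shift-* p r = +-cong (·-zero r) ≋.refl

*-assoc : ∀ p r s → (p *ₚ r) *ₚ s ≋ p *ₚ (r *ₚ s)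
*-assoc []       r s = ≋.refl
*-assoc (a ∷ as) r s =
  ≋.trans (*-distribʳ (a ·ₚ r) (+ 0 ∷ (as *ₚ r)) s)
          (+-cong (·-*-assoc a r s)
                  (≋.trans (shift-* (as *ₚ r) s) (∷-cong refl (*-assoc as r s))))

*-identityˡ : ∀ p → oneₚ *ₚ p ≋ p
*-identityˡ p = ≋.trans (+-cong (·-one p) zero∷[]) (+.identityʳ p)

*-cons : ∀ r a as → r *ₚ (a ∷ as) ≋ a ·ₚ r +ₚ (+ 0 ∷ (r *ₚ as))
*-cons []       a as = ≋.sym zero∷[]
*-cons (b ∷ bs) a as =
  ∷-cong (cong (ℤ._+ + 0) (ℤP.*-comm b a))
    (≋.trans (+-cong (≋.refl {b ·ₚ as}) (*-cons bs a as))
             (x∙yz≈y∙xz (b ·ₚ as) (a ·ₚ bs) (+ 0 ∷ (bs *ₚ as))))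

*-comm : ∀ p r → p *ₚ r ≋ r *ₚ p
*-comm []       r = ≋.sym (*-zeroʳ r)
*-comm (a ∷ as) r =
  ≋.trans (+-cong (≋.refl {a ·ₚ r}) (∷-cong refl (*-comm as r))) (≋.sym (*-cons r a as))

polySemiring : CommutativeSemiring 0ℓ 0ℓ
polySemiring = record
  { Carrier = Poly ; _≈_ = _≋_ ; _+_ = _+ₚ_ ; _*_ = _*ₚ_ ; 0# = [] ; 1# = oneₚ
  ; isCommutativeSemiring = isCommutativeSemiringˡ record
    { +-isCommutativeMonoid = +.isCommutativeMonoid
    ; *-isCommutativeMonoid = isCommutativeMonoidˡ record
      { isSemigroup = record
        { isMagma = record { isEquivalence = ≋-isEquivalence ; ∙-cong = *-cong }
        ; assoc   = *-assoc }
      ; identityˡ = *-identityˡ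
      ; comm      = *-comm }
    ; distribʳ = λ r p p' → *-distribʳ p p' r
    ; zeroˡ    = λ _ → ≋.refl } }

-- From here on, d ∣ p is divisibility in this semiring: c *ₚ d ≋ p for
-- some polynomial c, the form in which the theorem is stated.
open CommutativeSemiring polySemiring using (*-identityʳ; semiring; *-rawMagma; *-commutativeSemigroup)
open import Algebra.Definitions.RawMagma *-rawMagma using (_,_)
open import Algebra.Properties.Semiring.Divisibility semiring
  using (_∣_; _∣0; 1∣_; ∣ʳ-refl; ∣ʳ-reflexive; ∣ʳ-trans; ∣ʳ-respʳ-≈; ∣ʳ-respˡ-≈)
open import Algebra.Properties.CommutativeSemigroup.Divisibility *-commutativeSemigroup
  using (∙-cong-∣; x∣xy)
open import Algebra.Properties.CommutativeSemigroup *-commutativeSemigroup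
  using (xy∙z≈xz∙y)

∣-+ : ∀ {d p r} → d ∣ p → d ∣ r → d ∣ p +ₚ r
∣-+ {d} (c₁ , c₁d≋p) (c₂ , c₂d≋r) = c₁ +ₚ c₂ , ≋.trans (*-distribʳ c₁ c₂ d) (+-cong c₁d≋p c₂d≋r)

∣-sumₚ : ∀ {d} ps → All (d ∣_) ps → d ∣ sumₚ ps
∣-sumₚ []       []           = _ ∣0
∣-sumₚ (p ∷ ps) (d∣p ∷ d∣ps) = ∣-+ d∣p (∣-sumₚ ps d∣ps)

-- 1 + q + ⋯ + q^k, the cofactor of 1 - q in 1 - q^{k+1}.
geom : ℕ → Poly
geom zero    = oneₚ
geom (suc k) = + 1 ∷ geom k

geom-factor : ∀ k → geom k *ₚ oneMinusQ^ 1 ≋ oneMinusQ^ (suc k)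
geom-factor zero    = *-identityˡ (oneMinusQ^ 1)
geom-factor (suc k) =
  ≋.trans (+-cong (≋.refl {+ 1 ·ₚ oneMinusQ^ 1}) (∷-cong {+ 0} refl (geom-factor k))) ⟨ telescope ⟩
  where
  telescope : + 1 ·ₚ oneMinusQ^ 1 +ₚ (+ 0 ∷ oneMinusQ^ (suc k)) ≈ₚ oneMinusQ^ (suc (suc k))
  telescope zero          = refl
  telescope (suc zero)    = refl
  telescope (suc (suc j)) = refl

-- 1 - q divides 1 - q^a for every a (for a = 0 the latter is zero).
1-q∣1-q^ : ∀ a → oneMinusQ^ 1 ∣ oneMinusQ^ a
1-q∣1-q^ zero    = ∣ʳ-respʳ-≈ ⟨ (λ { zero → refl ; (suc k) → refl }) ⟩ (oneMinusQ^ 1 ∣0)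
1-q∣1-q^ (suc k) = geom k , geom-factor k

qfact-mono : ∀ {k m} → k ≤ m → qfact k ∣ qfact m
qfact-mono {k} k≤m = go (ℕP.≤⇒≤′ k≤m)
  where
  go : ∀ {m} → k ≤′ m → qfact k ∣ qfact m
  go ℕ.≤′-refl              = ∣ʳ-refl
  go (ℕ.≤′-step {m} k≤′m) = ∣ʳ-trans (go k≤′m) (x∣xy (qfact m) (oneMinusQ^ (suc m)))

-- Lengthening a row of length x, above a row of length h, raises the
-- gap x ∸ h by one unless it stays 0; either way the new factor of Δ
-- divides the old one times 1 - q^{new gap}.
qfact-gap-step : ∀ x h → qfact (suc x ∸ h) ∣ qfact (x ∸ h) *ₚ oneMinusQ^ (suc x ∸ h)
qfact-gap-step x       zero          = ∣ʳ-refl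
qfact-gap-step zero    (suc zero)    = 1∣ _
qfact-gap-step zero    (suc (suc h)) = 1∣ _
qfact-gap-step (suc x) (suc h)       = qfact-gap-step x h

qfact-0∸ : ∀ h → qfact (0 ∸ h) ≡ oneₚ
qfact-0∸ zero    = refl
qfact-0∸ (suc h) = refl

firstRow-grows : ∀ r μ → nth μ 0 ≤ nth (addBox r μ) 0
firstRow-grows zero    []       = z≤n
firstRow-grows zero    (x ∷ xs) = ℕP.n≤1+n x
firstRow-grows (suc r) []       = z≤n
firstRow-grows (suc r) (x ∷ xs) = ℕP.≤-refl

-- The gap μ'_r - μ'_{r+1} of μ' = μ + □ (box in row r): the exponent
-- of the factor this step contributes to ρ.
gap : ℕ → List ℕ → ℕ
gap r μ = nth (addBox r μ) r ∸ nth (addBox r μ) (suc r)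

-- One box addition multiplies Δ by at most the factor 1 - q^{gap}:
-- row r gains one factor (qfact-gap-step) while the factor of row r-1
-- can only shrink (qfact-mono).  Rows created beyond the end of μ have
-- length 0 and contribute the factor (0)_q = 1.
Δ-addBox : ∀ r μ → Δ (addBox r μ) ∣ Δ μ *ₚ oneMinusQ^ (gap r μ)
Δ-addBox zero    []       = ∣ʳ-reflexive (*-identityʳ (oneₚ *ₚ oneMinusQ^ 1))
Δ-addBox zero    (x ∷ xs) =
  ∣ʳ-respʳ-≈ (xy∙z≈xz∙y (qfact (x ∸ nth xs 0)) (oneMinusQ^ (suc x ∸ nth xs 0)) (Δ xs))
    (∙-cong-∣ (qfact-gap-step x (nth xs 0)) ∣ʳ-refl)
Δ-addBox (suc r) []       = ∣ʳ-respˡ-≈ Δys≋Δ0∷ys (Δ-addBox r [])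
  where
  ys = addBox r []
  Δys≋Δ0∷ys : Δ ys ≋ Δ (0 ∷ ys)
  Δys≋Δ0∷ys = ≋.sym (≋.trans (*-congˡ (Δ ys) (≋.reflexive (qfact-0∸ (nth ys 0)))) (*-identityˡ (Δ ys)))
Δ-addBox (suc r) (x ∷ xs) =
  ∣ʳ-respʳ-≈ (≋.sym (*-assoc (qfact (x ∸ nth xs 0)) (Δ xs) (oneMinusQ^ (gap r xs))))
    (∙-cong-∣ (qfact-mono (ℕP.∸-monoʳ-≤ x (firstRow-grows r xs))) (Δ-addBox r xs))

Δ-∣-ρ : ∀ μ w → Δ (shapeFrom μ w) ∣ Δ μ *ₚ rhoFrom μ w
Δ-∣-ρ μ []      = ∣ʳ-reflexive (≋.sym (*-identityʳ (Δ μ)))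
Δ-∣-ρ μ (r ∷ w) =
  ∣ʳ-respʳ-≈ (*-assoc (Δ μ) (oneMinusQ^ (gap r μ)) (rhoFrom (addBox r μ) w))
    (∣ʳ-trans (Δ-∣-ρ (addBox r μ) w) (∙-cong-∣ (Δ-addBox r μ) ∣ʳ-refl))

-- Each of the |w| factors of ρ is divisible by 1 - q.
oneMinusQPow-∣-ρ : ∀ μ w → oneMinusQPow (length w) ∣ rhoFrom μ w
oneMinusQPow-∣-ρ μ []      = ∣ʳ-refl
oneMinusQPow-∣-ρ μ (r ∷ w) = ∙-cong-∣ (1-q∣1-q^ (gap r μ)) (oneMinusQPow-∣-ρ (addBox r μ) w)

sumℕ-addBox : ∀ r μ → sumℕ (addBox r μ) ≡ suc (sumℕ μ)
sumℕ-addBox zero    []       = refl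
sumℕ-addBox zero    (x ∷ xs) = refl
sumℕ-addBox (suc r) []       = sumℕ-addBox r []
sumℕ-addBox (suc r) (x ∷ xs) = ≡.trans (cong (x ℕ.+_) (sumℕ-addBox r xs)) (ℕP.+-suc x (sumℕ xs))

sumℕ-shapeFrom : ∀ μ w → sumℕ (shapeFrom μ w) ≡ sumℕ μ ℕ.+ length w
sumℕ-shapeFrom μ []      = ≡.sym (ℕP.+-identityʳ (sumℕ μ))
sumℕ-shapeFrom μ (r ∷ w) =
  ≡.trans (sumℕ-shapeFrom (addBox r μ) w)
    (≡.trans (cong (ℕ._+ length w) (sumℕ-addBox r μ)) (≡.sym (ℕP.+-suc (sumℕ μ) (length w))))

ζ-integral : ∀ n λ' → sumℕ λ' ≡ n → ∀ P Q → sh P ≡ λ' → sh Q ≡ λ' →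
             oneMinusQPow n *ₚ Δ λ' ∣ ρ P *ₚ ρ Q
ζ-integral n λ' |λ'|≡n P Q shP≡λ' shQ≡λ' = ∙-cong-∣ [1-q]ⁿ∣ρP Δλ∣ρQ
  where
  |P|≡n : length P ≡ n
  |P|≡n = ≡.trans (≡.sym (sumℕ-shapeFrom [] P)) (≡.trans (cong sumℕ shP≡λ') |λ'|≡n)
  [1-q]ⁿ∣ρP : oneMinusQPow n ∣ ρ P
  [1-q]ⁿ∣ρP = ≡.subst (λ m → oneMinusQPow m ∣ ρ P) |P|≡n (oneMinusQPow-∣-ρ [] P)
  Δλ∣ρQ : Δ λ' ∣ ρ Q
  Δλ∣ρQ = ≡.subst (λ μ → Δ μ ∣ ρ Q) shQ≡λ' (∣ʳ-respʳ-≈ (*-identityˡ (ρ Q)) (Δ-∣-ρ [] Q))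

listEqℕB-sound : ∀ xs ys → listEqℕB xs ys ≡ true → xs ≡ ys
listEqℕB-sound []       []       _ = refl
listEqℕB-sound (x ∷ xs) (y ∷ ys) e with x ℕ.≟ y
listEqℕB-sound (x ∷ xs) (.x ∷ ys) e | yes refl = cong (x ∷_) (listEqℕB-sound xs ys e)
listEqℕB-sound (x ∷ xs) (y ∷ ys) () | no _

∧-elimʳ : ∀ a b → a ∧ b ≡ true → b ≡ true
∧-elimʳ true b e = e

sytsOfShape-shape : ∀ n λ' → All (λ w → sh w ≡ λ') (sytsOfShape n λ')
sytsOfShape-shape n λ' =
  All.map (λ {w} e → listEqℕB-sound (sh w) λ' (∧-elimʳ (validFrom [] w) _ e))
    (all-filter (λ w → (validFrom [] w ∧ listEqℕB (sh w) λ') Bool.≟ true) (words n n))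

mainTheorem8 : (n : ℕ) → n ≥ 1 → (λ' : List ℕ) → λ' ⊢ n →
    ((P Q : Tableau) → IsSYT P → sh P ≡ λ' → IsSYT Q → sh Q ≡ λ' →
      Σ Poly (λ ζ → ζ *ₚ (oneMinusQPow n *ₚ Δ λ') ≈ₚ ρ P *ₚ ρ Q))
    × Σ Poly (λ θ → θ *ₚ (oneMinusQPow n *ₚ Δ λ') ≈ₚ thetaNum n λ')
mainTheorem8 n _ λ' (_ , |λ'|≡n) = ζ-poly , asPoly θ-integral
  where
  asPoly : ∀ {p} → oneMinusQPow n *ₚ Δ λ' ∣ p → Σ Poly (λ c → c *ₚ (oneMinusQPow n *ₚ Δ λ') ≈ₚ p)
  asPoly (c , e) = c , coeff-≡ e

  ζ-poly : (P Q : Tableau) → IsSYT P → sh P ≡ λ' → IsSYT Q → sh Q ≡ λ' →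
           Σ Poly (λ ζ → ζ *ₚ (oneMinusQPow n *ₚ Δ λ') ≈ₚ ρ P *ₚ ρ Q)
  ζ-poly P Q _ shP _ shQ = asPoly (ζ-integral n λ' |λ'|≡n P Q shP shQ)

  θ-integral : oneMinusQPow n *ₚ Δ λ' ∣ thetaNum n λ'
  θ-integral = ∣-sumₚ _ (concat⁺ (map⁺ (All.map (λ {P} shP → map⁺ (All.map (λ {Q} shQ →
    ζ-integral n λ' |λ'|≡n P Q shP shQ) syts)) syts)))
    where syts = sytsOfShape-shape n λ'
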